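{- Let $N \ge 1$, let $G_N$ be the divisibility graph on $X_N=\{1,\dots,N\}$, and let $p \le N$ be a prime. Put $M(p)=\left\lfloor \frac{N}{p}\right\rfloor$ and let $e_p$ be the number of unordered pairs $\{i,j\}$ of distinct neighbours of $p$ in $G_N$ such that $i$ and $j$ are adjacent. Then $$e_p = \sum_{j=2}^{M(p)} \left\lfloor \frac{M(p)}{j} \right\rfloor.$$
   Context: The divisibility graph $G_N$ is the simple undirected graph with vertex set $X_N=\{1,\dots,N\}$, in which two distinct vertices $i \ne j$ are adjacent if and only if $i$ divides $j$ or $j$ divides $i$ (no loops). Two vertices are neighbours if they are adjacent. $\lfloor x \rfloor$ denotes the floor of $x$; an empty sum is $0$. -}

module Defs where

open import Data.Nat using (ℕ; zero; suc; _+_; _≤_; _<_; _/_; _≟_)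
open import Data.Nat.Divisibility using (_∣_; _∣?_)
open import Data.Nat.Properties using (_<?_)
open import Data.List using (List; []; _∷_; length; filter; concatMap; map; upTo)
open import Data.Nat.ListAction using (sum)
open import Data.Product using (_×_; _,_; proj₁; proj₂)
open import Data.Sum using (_⊎_)
open import Relation.Nullary using (¬_; Dec; yes; no)
open import Relation.Nullary.Decidable using (_×-dec_; _⊎-dec_; ¬?)
open import Relation.Binary.PropositionalEquality using (_≡_)

X : ℕ → List ℕ
X N = map suc (upTo N)

Adj : ℕ → ℕ → Set
Adj i j = (¬ (i ≡ j)) × ((i ∣ j) ⊎ (j ∣ i))

adj? : (i j : ℕ) → Dec (Adj i j)
adj? i j = ¬? (i ≟ j) ×-dec ((i ∣? j) ⊎-dec (j ∣? i))

-- Unordered pairs {i,j} of distinct vertices of X_N, represented as (i , j) with i < j.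
pairs : ℕ → List (ℕ × ℕ)
pairs N = concatMap (λ i → map (λ j → (i , j)) (X N)) (X N)

OrderedPair : ℕ × ℕ → Set
OrderedPair (i , j) = i < j

TriPair : ℕ → ℕ × ℕ → Set
TriPair p (i , j) = (i < j) × (Adj p i × (Adj p j × Adj i j))

triPair? : (p : ℕ) → (x : ℕ × ℕ) → Dec (TriPair p x)
triPair? p (i , j) = (i <? j) ×-dec (adj? p i ×-dec (adj? p j ×-dec adj? i j))

e : (N p : ℕ) → ℕ
e N p = length (filter (triPair? p) (pairs N))

-- floorSum M = Σ_{j=2}^{M} ⌊M/j⌋  (empty sum = 0 when M < 2).
-- The list  map suc (upTo M)  is [1,…,M]; we keep j with 2 ≤ j.
-- Division by j = suc k is written with the explicit nonzero form.
floorSum : ℕ → ℕ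
floorSum M = sum (map (λ k → M / suc k) (filter (λ k → 1 Data.Nat.≤? k) (upTo M)))

{-# OPTIONS --safe #-}
module Submission where

-- The neighbours of p in G_N are 1 and the multiples a·p with 2 ≤ a ≤ M = ⌊N/p⌋.
-- Sending 1 ↦ 1 and a·p ↦ a identifies the adjacent pairs of neighbours with the
-- pairs a < b ≤ M such that a ∣ b: every pair {1, b·p} is adjacent, and {a·p, b·p}
-- is adjacent exactly when a ∣ b. For each a there are ⌊M/a⌋ − 1 such b, so
-- e_p = Σ_{a=1}^{M} (⌊M/a⌋ − 1) = Σ_{a=2}^{M} ⌊M/a⌋.

open import Defs
open import Data.Bool using (true; false; if_then_else_)
open import Data.List using (List; []; _∷_; _++_; [_]; concat; length; filter; map; upTo; applyUpTo)
open import Data.List.Properties using (map-++; map-∘; map-concatMap; upTo-∷ʳ; map-upTo; filter-all)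
open import Data.List.Relation.Unary.All.Properties using (applyUpTo⁺₁)
open import Data.Nat using (ℕ; zero; suc; _+_; _*_; _∸_; _≤_; _<_; _/_; _≟_; _≤?_; NonZero; z≤n; s≤s; s≤s⁻¹; z<s; >-nonZero; >-nonZero⁻¹; nonTrivial⇒n>1)
open import Data.Nat.Divisibility
open import Data.Nat.DivMod
open import Data.Nat.ListAction using (sum)
open import Data.Nat.ListAction.Properties using (sum-++)
open import Data.Nat.Primality using (Prime; prime⇒irreducible; prime⇒nonTrivial)
open import Data.Nat.Properties
open import Algebra.Properties.CommutativeSemigroup +-commutativeSemigroup using (interchange)
open import Data.Product using (_×_; _,_; proj₁; proj₂)
open import Data.Sum using (inj₁; inj₂)
open import Function using (_∘_; _⇔_; mk⇔; Equivalence)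
open import Relation.Nullary using (¬_; Dec; yes; no; does; contradiction)
open import Relation.Nullary.Decidable using (_×-dec_; dec-true; dec-false; does-⇔)
open import Relation.Binary.PropositionalEquality using (_≡_; _≢_; refl; sym; trans; cong; cong₂; subst)
open Relation.Binary.PropositionalEquality.≡-Reasoning

private variable
  P Q : Set

when : Dec P → ℕ → ℕ
when P? n = if does P? then n else 0

𝟙 : Dec P → ℕ
𝟙 P? = when P? 1

when-yes : (P? : Dec P) (n : ℕ) → P → when P? n ≡ n
when-yes P? n p rewrite dec-true P? p = refl

when-no : (P? : Dec P) (n : ℕ) → ¬ P → when P? n ≡ 0
when-no P? n ¬p rewrite dec-false P? ¬p = refl

𝟙-⇔ : (P? : Dec P) (Q? : Dec Q) → P ⇔ Q → 𝟙 P? ≡ 𝟙 Q?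
𝟙-⇔ P? Q? P⇔Q = cong (λ b → if b then 1 else 0) (does-⇔ P⇔Q P? Q?)

∑ : ℕ → (ℕ → ℕ) → ℕ
∑ zero    f = 0
∑ (suc n) f = ∑ n f + f (suc n)

syntax ∑ n (λ i → e) = ∑[ i ≤ n ] e

∑-cong : ∀ n {f g : ℕ → ℕ} → (∀ {i} → 1 ≤ i → i ≤ n → f i ≡ g i) → ∑ n f ≡ ∑ n g
∑-cong zero    eq = refl
∑-cong (suc n) eq = cong₂ _+_ (∑-cong n (λ 1≤i i≤n → eq 1≤i (m≤n⇒m≤1+n i≤n))) (eq (s≤s z≤n) ≤-refl)

∑-+ : ∀ n (f g : ℕ → ℕ) → ∑[ i ≤ n ] (f i + g i) ≡ ∑ n f + ∑ n g
∑-+ zero    f g = refl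
∑-+ (suc n) f g = trans (cong (_+ (f (suc n) + g (suc n))) (∑-+ n f g)) (interchange (∑ n f) (∑ n g) _ _)

∑-const : ∀ n c → ∑[ i ≤ n ] c ≡ n * c
∑-const zero    c = refl
∑-const (suc n) c = trans (cong (_+ c) (∑-const n c)) (+-comm (n * c) c)

∑-zero : ∀ n {f : ℕ → ℕ} → (∀ {i} → 1 ≤ i → i ≤ n → f i ≡ 0) → ∑ n f ≡ 0
∑-zero n eq = trans (∑-cong n eq) (trans (∑-const n 0) (*-zeroʳ n))

∑-suc : ∀ n (f : ℕ → ℕ) → ∑ (suc n) f ≡ f 1 + ∑[ i ≤ n ] f (suc i)
∑-suc zero    f = +-comm 0 (f 1)
∑-suc (suc n) f = trans (cong (_+ f (suc (suc n))) (∑-suc n f)) (+-assoc (f 1) _ _)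

∑-when-≡ : ∀ n {x} c → 1 ≤ x → x ≤ n → ∑[ i ≤ n ] when (i ≟ x) c ≡ c
∑-when-≡ zero    c (s≤s _) ()
∑-when-≡ (suc n) {x} c 1≤x x≤1+n with suc n ≟ x
... | yes refl = cong₂ _+_ (∑-zero n (λ _ i≤n → when-no (_ ≟ suc n) c (<⇒≢ (s≤s i≤n)))) (when-yes (suc n ≟ suc n) c refl)
... | no 1+n≢x = begin
  ∑[ i ≤ n ] when (i ≟ x) c + when (suc n ≟ x) c ≡⟨ cong (∑[ i ≤ n ] when (i ≟ x) c +_) (when-no (suc n ≟ x) c 1+n≢x) ⟩
  ∑[ i ≤ n ] when (i ≟ x) c + 0                  ≡⟨ +-identityʳ _ ⟩
  ∑[ i ≤ n ] when (i ≟ x) c                      ≡⟨ ∑-when-≡ n c 1≤x (s≤s⁻¹ (≤∧≢⇒< x≤1+n (1+n≢x ∘ sym))) ⟩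
  c                                               ∎

n+∑[f∸1]≡∑f : ∀ n (f : ℕ → ℕ) → (∀ {i} → 1 ≤ i → i ≤ n → 1 ≤ f i) → n + ∑[ i ≤ n ] (f i ∸ 1) ≡ ∑ n f
n+∑[f∸1]≡∑f n f positive = begin
  n + ∑[ i ≤ n ] (f i ∸ 1)             ≡⟨ +-comm n _ ⟩
  ∑[ i ≤ n ] (f i ∸ 1) + n             ≡⟨ cong (∑[ i ≤ n ] (f i ∸ 1) +_) (trans (∑-const n 1) (*-identityʳ n)) ⟨
  ∑[ i ≤ n ] (f i ∸ 1) + ∑[ i ≤ n ] 1  ≡⟨ ∑-+ n _ _ ⟨
  ∑[ i ≤ n ] (f i ∸ 1 + 1)             ≡⟨ ∑-cong n (λ 1≤i i≤n → m∸n+n≡m (positive 1≤i i≤n)) ⟩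
  ∑ n f                                ∎

length-filter≡sum-𝟙 : {A : Set} {R : A → Set} (R? : ∀ x → Dec (R x)) (xs : List A) →
  length (filter R? xs) ≡ sum (map (𝟙 ∘ R?) xs)
length-filter≡sum-𝟙 R? []       = refl
length-filter≡sum-𝟙 R? (x ∷ xs) with does (R? x)
... | true  = cong suc (length-filter≡sum-𝟙 R? xs)
... | false = length-filter≡sum-𝟙 R? xs

sum-concat : (xss : List (List ℕ)) → sum (concat xss) ≡ sum (map sum xss)
sum-concat []         = refl
sum-concat (xs ∷ xss) = trans (sum-++ xs (concat xss)) (cong (sum xs +_) (sum-concat xss))

sum-map-X : ∀ n (f : ℕ → ℕ) → sum (map f (X n)) ≡ ∑ n f
sum-map-X zero    f = refl
sum-map-X (suc n) f = begin
  sum (map f (map suc (upTo (suc n))))         ≡⟨ cong (sum ∘ map f ∘ map suc) (upTo-∷ʳ n) ⟨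
  sum (map f (map suc (upTo n ++ [ n ])))      ≡⟨ cong (sum ∘ map f) (map-++ suc (upTo n) [ n ]) ⟩
  sum (map f (X n ++ [ suc n ]))               ≡⟨ cong sum (map-++ f (X n) [ suc n ]) ⟩
  sum (map f (X n) ++ [ f (suc n) ])           ≡⟨ sum-++ (map f (X n)) [ f (suc n) ] ⟩
  sum (map f (X n)) + (f (suc n) + 0)          ≡⟨ cong₂ _+_ (sum-map-X n f) (+-identityʳ (f (suc n))) ⟩
  ∑ n f + f (suc n)                            ∎

e≡∑∑ : ∀ N p → e N p ≡ ∑[ i ≤ N ] ∑[ j ≤ N ] 𝟙 (triPair? p (i , j))
e≡∑∑ N p = begin
  e N p                                                        ≡⟨ length-filter≡sum-𝟙 (triPair? p) (pairs N) ⟩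
  sum (map F (pairs N))                                        ≡⟨ cong sum (map-concatMap F row (X N)) ⟩
  sum (concat (map (map F ∘ row) (X N)))                       ≡⟨ sum-concat (map (map F ∘ row) (X N)) ⟩
  sum (map sum (map (map F ∘ row) (X N)))                      ≡⟨ cong sum (map-∘ (X N)) ⟨
  sum (map (λ i → sum (map F (row i))) (X N))                  ≡⟨ sum-map-X N _ ⟩
  ∑[ i ≤ N ] sum (map F (row i))                               ≡⟨ ∑-cong N (λ {i} _ _ → rowSum i) ⟩
  ∑[ i ≤ N ] ∑[ j ≤ N ] F (i , j)                              ∎
  where
  F : ℕ × ℕ → ℕ
  F = 𝟙 ∘ triPair? p
  row : ℕ → List (ℕ × ℕ)
  row i = map (i ,_) (X N)
  rowSum : ∀ i → sum (map F (row i)) ≡ ∑[ j ≤ N ] F (i , j)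
  rowSum i = trans (cong sum (sym (map-∘ (X N)))) (sum-map-X N (λ j → F (i , j)))

floorSum-suc : ∀ m → floorSum (suc m) ≡ ∑[ k ≤ m ] (suc m / suc k)
floorSum-suc m = begin
  sum (map (λ k → suc m / suc k) (filter (1 ≤?_) (applyUpTo suc m)))
    ≡⟨ cong (sum ∘ map _) (filter-all (1 ≤?_) (applyUpTo⁺₁ suc m (λ _ → s≤s z≤n))) ⟩
  sum (map (λ k → suc m / suc k) (applyUpTo suc m))                   ≡⟨ cong (sum ∘ map _) (map-upTo suc m) ⟨
  sum (map (λ k → suc m / suc k) (X m))                               ≡⟨ sum-map-X m _ ⟩
  ∑[ k ≤ m ] (suc m / suc k)                                          ∎

/-unique : ∀ {m n q} .⦃ _ : NonZero n ⦄ → q * n ≤ m → m < suc q * n → m / n ≡ q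
/-unique {m} {n} {q} lower upper = ≤-antisym
  (s≤s⁻¹ (m<n*o⇒m/o<n upper))
  (subst (_≤ m / n) (m*n/n≡m q n) (/-monoˡ-≤ n lower))

m<[1+m/n]*n : ∀ m n .⦃ _ : NonZero n ⦄ → m < suc (m / n) * n
m<[1+m/n]*n m n = subst (_< suc (m / n) * n) (sym (m≡m%n+[m/n]*n m n))
  (+-monoˡ-< ((m / n) * n) (m%n<n m n))

[1+m]/n≡1+m/n : ∀ m n .⦃ _ : NonZero n ⦄ → n ∣ suc m → suc m / n ≡ suc (m / n)
[1+m]/n≡1+m/n m n (divides k 1+m≡k*n) = /-unique lower upper
  where
  lower : suc (m / n) * n ≤ suc m
  lower = subst (suc (m / n) * n ≤_) (sym 1+m≡k*n)
    (*-monoˡ-≤ n (*-cancelʳ-< n (m / n) k (subst (m / n * n <_) 1+m≡k*n (s≤s (m/n*n≤m m n)))))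
  upper : suc m < suc (suc (m / n)) * n
  upper = <-≤-trans (s≤s (m<[1+m/n]*n m n)) (m<n+m (suc (m / n) * n) (>-nonZero⁻¹ n))

[1+m]/n≡m/n : ∀ m n .⦃ _ : NonZero n ⦄ → ¬ n ∣ suc m → suc m / n ≡ m / n
[1+m]/n≡m/n m n n∤1+m = /-unique (≤-trans (m/n*n≤m m n) (n≤1+n m))
  (≤∧≢⇒< (m<[1+m/n]*n m n) (n∤1+m ∘ divides (suc (m / n))))

∑-multiples : ∀ N d .⦃ _ : NonZero d ⦄ (f : ℕ → ℕ) →
  ∑[ i ≤ N ] when (d ∣? i) (f (i / d)) ≡ ∑ (N / d) f
∑-multiples zero    d f = sym (cong (λ n → ∑ n f) (0/n≡0 d))
∑-multiples (suc N) d f with d ∣? suc N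
... | yes d∣1+N = begin
  ∑[ i ≤ N ] g i + f (suc N / d) ≡⟨ cong (_+ f (suc N / d)) (∑-multiples N d f) ⟩
  ∑ (N / d) f + f (suc N / d)    ≡⟨ cong (λ n → ∑ (N / d) f + f n) quotient≡ ⟩
  ∑ (suc (N / d)) f              ≡⟨ cong (λ n → ∑ n f) quotient≡ ⟨
  ∑ (suc N / d) f                ∎
  where
  g : ℕ → ℕ
  g i = when (d ∣? i) (f (i / d))
  quotient≡ : suc N / d ≡ suc (N / d)
  quotient≡ = [1+m]/n≡1+m/n N d d∣1+N
... | no d∤1+N = begin
  ∑[ i ≤ N ] g i + 0 ≡⟨ +-identityʳ _ ⟩
  ∑[ i ≤ N ] g i     ≡⟨ ∑-multiples N d f ⟩
  ∑ (N / d) f        ≡⟨ cong (λ n → ∑ n f) ([1+m]/n≡m/n N d d∤1+N) ⟨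
  ∑ (suc N / d) f    ∎
  where
  g : ℕ → ℕ
  g i = when (d ∣? i) (f (i / d))

count-multiples : ∀ N d .⦃ _ : NonZero d ⦄ → ∑[ j ≤ N ] 𝟙 (d ∣? j) ≡ N / d
count-multiples N d = trans (∑-multiples N d (λ _ → 1)) (trans (∑-const (N / d) 1) (*-identityʳ (N / d)))

properMultiples : ℕ → ℕ → ℕ
properMultiples N d = ∑[ j ≤ N ] 𝟙 ((d <? j) ×-dec (d ∣? j))

𝟙-∣-split : ∀ d {j} → 1 ≤ j → 𝟙 (d ∣? j) ≡ 𝟙 ((d <? j) ×-dec (d ∣? j)) + 𝟙 (j ≟ d)
𝟙-∣-split d {j} 1≤j with j ≟ d
... | yes refl = trans (when-yes (j ∣? j) 1 ∣-refl)
  (sym (cong₂ _+_ (when-no ((j <? j) ×-dec (j ∣? j)) 1 (<-irrefl refl ∘ proj₁)) (when-yes (j ≟ j) 1 refl)))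
... | no  j≢d  = begin
  𝟙 (d ∣? j)                               ≡⟨ 𝟙-⇔ (d ∣? j) ((d <? j) ×-dec (d ∣? j)) (mk⇔ proper proj₂) ⟩
  𝟙 ((d <? j) ×-dec (d ∣? j))              ≡⟨ +-identityʳ _ ⟨
  𝟙 ((d <? j) ×-dec (d ∣? j)) + 0          ≡⟨ cong (𝟙 ((d <? j) ×-dec (d ∣? j)) +_) (when-no (j ≟ d) 1 j≢d) ⟨
  𝟙 ((d <? j) ×-dec (d ∣? j)) + 𝟙 (j ≟ d)  ∎
  where
  proper : d ∣ j → d < j × d ∣ j
  proper d∣j = ≤∧≢⇒< (∣⇒≤ ⦃ >-nonZero 1≤j ⦄ d∣j) (j≢d ∘ sym) , d∣j

properMultiples≡ : ∀ N d .⦃ _ : NonZero d ⦄ → d ≤ N → properMultiples N d ≡ N / d ∸ 1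
properMultiples≡ N d d≤N = sym (trans (cong (_∸ 1) counted) (m+n∸n≡m (properMultiples N d) 1))
  where
  counted : N / d ≡ properMultiples N d + 1
  counted = begin
    N / d                                                      ≡⟨ count-multiples N d ⟨
    ∑[ j ≤ N ] 𝟙 (d ∣? j)                                      ≡⟨ ∑-cong N (λ 1≤j _ → 𝟙-∣-split d 1≤j) ⟩
    ∑[ j ≤ N ] (𝟙 ((d <? j) ×-dec (d ∣? j)) + 𝟙 (j ≟ d))       ≡⟨ ∑-+ N _ _ ⟩
    properMultiples N d + ∑[ j ≤ N ] 𝟙 (j ≟ d)                 ≡⟨ cong (properMultiples N d +_) (∑-when-≡ N 1 (>-nonZero⁻¹ d) d≤N) ⟩
    properMultiples N d + 1                                    ∎

properMultiples-/ : ∀ N {d i} .⦃ _ : NonZero d ⦄ → d ∣ i → 1 ≤ i → i ≤ N →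
  properMultiples N i ≡ properMultiples (N / d) (i / d)
properMultiples-/ N {d} {i} d∣i 1≤i i≤N = begin
  properMultiples N i          ≡⟨ properMultiples≡ N i i≤N ⟩
  N / i ∸ 1                    ≡⟨ cong (_∸ 1) (/-congʳ (sym (m*[n/m]≡n d∣i))) ⟩
  N / (d * a) ∸ 1              ≡⟨ cong (_∸ 1) (m/n/o≡m/[n*o] N d a) ⟨
  N / d / a ∸ 1                ≡⟨ properMultiples≡ (N / d) a (/-monoˡ-≤ d i≤N) ⟨
  properMultiples (N / d) a    ∎
  where
  a = i / d
  instance
    i≢0 : NonZero i
    i≢0 = >-nonZero 1≤i
    a≢0 : NonZero a
    a≢0 = >-nonZero (m≥n⇒m/n>0 (∣⇒≤ d∣i))
    da≢0 : NonZero (d * a)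
    da≢0 = m*n≢0 d a

divisorPairs : ℕ → ℕ
divisorPairs M = ∑[ a ≤ M ] properMultiples M a

divisorPairs≡floorSum : ∀ M → divisorPairs M ≡ floorSum M
divisorPairs≡floorSum zero    = refl
divisorPairs≡floorSum (suc m) = begin
  divisorPairs (suc m)
    ≡⟨ ∑-suc m (properMultiples (suc m)) ⟩
  properMultiples (suc m) 1 + ∑[ k ≤ m ] properMultiples (suc m) (suc k)
    ≡⟨ cong₂ _+_ first (∑-cong m (λ {k} _ k≤m → properMultiples≡ (suc m) (suc k) (s≤s k≤m))) ⟩
  m + ∑[ k ≤ m ] (suc m / suc k ∸ 1)
    ≡⟨ n+∑[f∸1]≡∑f m (λ k → suc m / suc k) (λ _ k≤m → m≥n⇒m/n>0 (s≤s k≤m)) ⟩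
  ∑[ k ≤ m ] (suc m / suc k)
    ≡⟨ floorSum-suc m ⟨
  floorSum (suc m)
    ∎
  where
  first : properMultiples (suc m) 1 ≡ m
  first = trans (properMultiples≡ (suc m) 1 (s≤s z≤n)) (cong (_∸ 1) (n/1≡n (suc m)))

module _ {p : ℕ} (p-prime : Prime p) where

  1<p : 1 < p
  1<p = nonTrivial⇒n>1 p ⦃ prime⇒nonTrivial p-prime ⦄

  adj⇔ : ∀ {i} → 2 ≤ i → Adj p i ⇔ (p ≢ i × p ∣ i)
  adj⇔ {i} 2≤i = mk⇔ to (λ (p≢i , p∣i) → p≢i , inj₁ p∣i)
    where
    to : Adj p i → p ≢ i × p ∣ i
    to (p≢i , inj₁ p∣i) = p≢i , p∣i
    to (p≢i , inj₂ i∣p) with prime⇒irreducible p-prime i∣p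
    ... | inj₁ refl = contradiction 2≤i (<-irrefl refl)
    ... | inj₂ refl = contradiction refl p≢i

  triPair-1⇔ : ∀ {j} → TriPair p (1 , j) ⇔ (p < j × p ∣ j)
  triPair-1⇔ {j} = mk⇔ to from
    where
    to : TriPair p (1 , j) → p < j × p ∣ j
    to (1<j , _ , adjPj , _) with Equivalence.to (adj⇔ 1<j) adjPj
    ... | p≢j , p∣j = ≤∧≢⇒< (∣⇒≤ ⦃ >-nonZero (<-trans z<s 1<j) ⦄ p∣j) p≢j , p∣j
    from : p < j × p ∣ j → TriPair p (1 , j)
    from (p<j , p∣j) = 1<j , (<⇒≢ 1<p ∘ sym , inj₂ (1∣ p)) ,
      Equivalence.from (adj⇔ 1<j) (<⇒≢ p<j , p∣j) , (<⇒≢ 1<j , inj₁ (1∣ j))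
      where 1<j = <-trans 1<p p<j

  triPair⇔ : ∀ {i j} → 2 ≤ i → TriPair p (i , j) ⇔ ((p ≢ i × p ∣ i) × (i < j × i ∣ j))
  triPair⇔ {i} {j} 2≤i = mk⇔ to from
    where
    instance
      i≢0 : NonZero i
      i≢0 = >-nonZero (<-trans z<s 2≤i)
    to : TriPair p (i , j) → (p ≢ i × p ∣ i) × (i < j × i ∣ j)
    to (i<j , adjPi , _ , (_ , inj₁ i∣j)) = Equivalence.to (adj⇔ 2≤i) adjPi , i<j , i∣j
    to (i<j , _     , _ , (_ , inj₂ j∣i)) = contradiction (∣⇒≤ j∣i) (<⇒≱ i<j)
    from : (p ≢ i × p ∣ i) × (i < j × i ∣ j) → TriPair p (i , j)
    from ((p≢i , p∣i) , i<j , i∣j) = i<j , Equivalence.from (adj⇔ 2≤i) (p≢i , p∣i) ,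
      Equivalence.from (adj⇔ (≤-trans 2≤i (<⇒≤ i<j))) (<⇒≢ (≤-<-trans (∣⇒≤ p∣i) i<j) , ∣-trans p∣i i∣j) ,
      (<⇒≢ i<j , inj₁ i∣j)

  module _ (N : ℕ) .⦃ _ : NonZero p ⦄ (p≤N : p ≤ N) where

    e-row : ℕ → ℕ
    e-row i = ∑[ j ≤ N ] 𝟙 (triPair? p (i , j))

    M : ℕ
    M = N / p

    c : ℕ
    c = properMultiples M 1

    e-row-1 : e-row 1 ≡ c
    e-row-1 = begin
      e-row 1                     ≡⟨ ∑-cong N (λ {j} _ _ → 𝟙-⇔ (triPair? p (1 , j)) ((p <? j) ×-dec (p ∣? j)) triPair-1⇔) ⟩
      properMultiples N p         ≡⟨ properMultiples-/ N ∣-refl (<⇒≤ 1<p) p≤N ⟩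
      properMultiples M (p / p)   ≡⟨ cong (properMultiples M) (n/n≡1 p) ⟩
      c                           ∎

    e-row-zero : ∀ {i} → 2 ≤ i → ¬ (p ≢ i × p ∣ i) → e-row i ≡ 0
    e-row-zero {i} 2≤i ¬adj = ∑-zero N (λ {j} _ _ →
      when-no (triPair? p (i , j)) 1 (¬adj ∘ proj₁ ∘ Equivalence.to (triPair⇔ 2≤i)))

    e-row-multiple : ∀ {i} → 2 ≤ i → i ≤ N → p ≢ i → p ∣ i → e-row i ≡ properMultiples M (i / p)
    e-row-multiple {i} 2≤i i≤N p≢i p∣i = begin
      e-row i                     ≡⟨ ∑-cong N (λ {j} _ _ → 𝟙-⇔ (triPair? p (i , j)) ((i <? j) ×-dec (i ∣? j)) divisibleFrom) ⟩
      properMultiples N i         ≡⟨ properMultiples-/ N p∣i (<-trans z<s 2≤i) i≤N ⟩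
      properMultiples M (i / p)   ∎
      where
      divisibleFrom : ∀ {j} → TriPair p (i , j) ⇔ (i < j × i ∣ j)
      divisibleFrom = mk⇔ (proj₂ ∘ Equivalence.to (triPair⇔ 2≤i)) (Equivalence.from (triPair⇔ 2≤i) ∘ ((p≢i , p∣i) ,_))

    -- Row 1 plays the role of the cofactor a = 1, whose multiple p itself has an
    -- empty row; adding c on both sides makes this exchange a pointwise identity.
    e-row-swap : ∀ i → 1 ≤ i → i ≤ N →
      e-row i + when (i ≟ p) c ≡ when (p ∣? i) (properMultiples M (i / p)) + when (i ≟ 1) c
    e-row-swap 1 _ _ = begin
      e-row 1 + when (1 ≟ p) c      ≡⟨ cong₂ _+_ e-row-1 (when-no (1 ≟ p) c (<⇒≢ 1<p)) ⟩
      c + 0                         ≡⟨ +-comm c 0 ⟩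
      0 + c                         ≡⟨ cong (_+ c) (when-no (p ∣? 1) _ (<⇒≢ 1<p ∘ sym ∘ ∣1⇒≡1)) ⟨
      when (p ∣? 1) _ + c           ∎
    e-row-swap i@(suc (suc _)) _ i≤N = byCases (p ∣? i) (i ≟ p)
      where
      2≤i : 2 ≤ i
      2≤i = s≤s (s≤s z≤n)
      byCases : Dec (p ∣ i) → Dec (i ≡ p) →
        e-row i + when (i ≟ p) c ≡ when (p ∣? i) (properMultiples M (i / p)) + 0
      byCases (no p∤i) _ = begin
        e-row i + when (i ≟ p) c      ≡⟨ cong₂ _+_ (e-row-zero 2≤i (p∤i ∘ proj₂)) (when-no (i ≟ p) c (p∤i ∘ p∣i)) ⟩
        0                             ≡⟨ cong (_+ 0) (when-no (p ∣? i) _ p∤i) ⟨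
        when (p ∣? i) _ + 0           ∎
        where
        p∣i : i ≡ p → p ∣ i
        p∣i i≡p = subst (p ∣_) (sym i≡p) ∣-refl
      byCases (yes p∣i) (yes i≡p) = begin
        e-row i + when (i ≟ p) c      ≡⟨ cong₂ _+_ (e-row-zero 2≤i (λ (p≢i , _) → p≢i (sym i≡p))) (when-yes (i ≟ p) c i≡p) ⟩
        c                             ≡⟨ cong (properMultiples M) (trans (cong (_/ p) i≡p) (n/n≡1 p)) ⟨
        properMultiples M (i / p)     ≡⟨ when-yes (p ∣? i) _ p∣i ⟨
        when (p ∣? i) _               ≡⟨ +-identityʳ _ ⟨
        when (p ∣? i) _ + 0           ∎
      byCases (yes p∣i) (no i≢p) = begin
        e-row i + when (i ≟ p) c      ≡⟨ cong₂ _+_ (e-row-multiple 2≤i i≤N (i≢p ∘ sym) p∣i) (when-no (i ≟ p) c i≢p) ⟩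
        properMultiples M (i / p) + 0 ≡⟨ cong (_+ 0) (when-yes (p ∣? i) _ p∣i) ⟨
        when (p ∣? i) _ + 0           ∎

    e≡divisorPairs : e N p ≡ divisorPairs M
    e≡divisorPairs = +-cancelʳ-≡ c (e N p) (divisorPairs M) (begin
      e N p + c                                                         ≡⟨ cong₂ _+_ (e≡∑∑ N p) (sym (∑-when-≡ N c (<⇒≤ 1<p) p≤N)) ⟩
      ∑ N e-row + ∑[ i ≤ N ] when (i ≟ p) c                            ≡⟨ ∑-+ N _ _ ⟨
      ∑[ i ≤ N ] (e-row i + when (i ≟ p) c)                             ≡⟨ ∑-cong N (λ {i} → e-row-swap i) ⟩
      ∑[ i ≤ N ] (when (p ∣? i) (properMultiples M (i / p)) + when (i ≟ 1) c) ≡⟨ ∑-+ N _ _ ⟩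
      ∑[ i ≤ N ] when (p ∣? i) (properMultiples M (i / p)) + ∑[ i ≤ N ] when (i ≟ 1) c
        ≡⟨ cong₂ _+_ (∑-multiples N p (properMultiples M)) (∑-when-≡ N c ≤-refl (≤-trans (<⇒≤ 1<p) p≤N)) ⟩
      divisorPairs M + c                                                ∎)

corollary2 : (N p : ℕ) .⦃ _ : NonZero p ⦄ → 1 ≤ N → Prime p → p ≤ N →
    e N p ≡ floorSum (N / p)
corollary2 N p _ p-prime p≤N = trans (e≡divisorPairs p-prime N p≤N) (divisorPairs≡floorSum (N / p))
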